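{- Let $F_{hv}(t,q)$ be the generating series, by half-perimeter ($t$) and area ($q$), of convex polyominoes invariant under both a reflection in a horizontal axis and a reflection in a vertical axis, and let $P(x,y,q)$ be the generating series of nonempty Ferrers diagrams, with $x$ marking the largest part, $y$ the number of parts and $q$ the size. Then $$F_{hv}(t,q)=P(t^2,t^2,q^4)+\frac2t\,P\big(\tfrac{t^2}{q^2},t^2,q^4\big)+\frac{q}{t^2}\,P\big(\tfrac{t^2}{q^2},\tfrac{t^2}{q^2},q^4\big).$$
   Context: A polyomino is a finite edge-connected union of unit cells of the square lattice, up to translation; convex means its intersection with every horizontal and vertical line is connected. Half-perimeter is width plus height. A Ferrers diagram is the diagram of an integer partition. Invariance under a reflection means the reflection maps the polyomino to a translate of itself. -}

module Defs where

open import Data.Nat using (ℕ; zero; suc; _+_; _*_; _≤_)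
open import Data.Bool using (Bool; true; false)
open import Data.Fin using (Fin; toℕ; opposite)
open import Data.Vec using (Vec; []; _∷_; lookup)
open import Data.List using (List; []; _∷_; length)
open import Data.Nat.ListAction using (sum)
open import Data.List.Relation.Unary.All using (All)
open import Data.List.Relation.Unary.Linked using (Linked)
open import Data.List.Relation.Unary.Unique.Propositional using (Unique)
open import Data.List.Membership.Propositional using (_∈_)
open import Data.Product using (Σ; _×_; ∃; _,_)
open import Data.Sum using (_⊎_)
open import Function.Bundles using (_⇔_)
open import Relation.Binary.PropositionalEquality using (_≡_)

IsCount : {A : Set} → (A → Set) → ℕ → Set
IsCount {A} P k =
  Σ (List A) λ L → Unique L × length L ≡ k × ((x : A) → (x ∈ L) ⇔ P x)

-- Polyominoes, normalised up to translation: a w×h grid of cells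
-- (rows indexed by Fin h, columns by Fin w) whose bounding box is
-- exactly the grid (every row and every column contains a cell).

Grid : ℕ → ℕ → Set
Grid w h = Vec (Vec Bool w) h

Cell : ℕ → ℕ → Set
Cell w h = Fin h × Fin w

Filled : {w h : ℕ} → Grid w h → Cell w h → Set
Filled M (i , j) = lookup (lookup M i) j ≡ true

Adj : {w h : ℕ} → Cell w h → Cell w h → Set
Adj (i , j) (i' , j') =
  (i ≡ i' × (suc (toℕ j) ≡ toℕ j' ⊎ suc (toℕ j') ≡ toℕ j))
  ⊎ (j ≡ j' × (suc (toℕ i) ≡ toℕ i' ⊎ suc (toℕ i') ≡ toℕ i))

data Path {w h : ℕ} (M : Grid w h) : Cell w h → Cell w h → Set where
  here : ∀ {c} → Filled M c → Path M c c
  step : ∀ {c d e} → Filled M c → Adj c d → Path M d e → Path M c e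

NonEmpty : {w h : ℕ} → Grid w h → Set
NonEmpty M = ∃ λ c → Filled M c

EdgeConnected : {w h : ℕ} → Grid w h → Set
EdgeConnected M = ∀ c d → Filled M c → Filled M d → Path M c d

Tight : {w h : ℕ} → Grid w h → Set
Tight {w} {h} M =
  ((i : Fin h) → ∃ λ j → Filled M (i , j)) ×
  ((j : Fin w) → ∃ λ i → Filled M (i , j))

IsPolyomino : {w h : ℕ} → Grid w h → Set
IsPolyomino M = NonEmpty M × EdgeConnected M × Tight M

Convex : {w h : ℕ} → Grid w h → Set
Convex {w} {h} M =
  ((i : Fin h) (j k l : Fin w) → toℕ j ≤ toℕ k → toℕ k ≤ toℕ l →
     Filled M (i , j) → Filled M (i , l) → Filled M (i , k)) ×
  ((j : Fin w) (i k l : Fin h) → toℕ i ≤ toℕ k → toℕ k ≤ toℕ l →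
     Filled M (i , j) → Filled M (l , j) → Filled M (k , j))

-- reflection in a horizontal axis maps M to a translate of itself
-- (with the normalised bounding box, this is row i ↦ row h-1-i)
HSym : {w h : ℕ} → Grid w h → Set
HSym {w} {h} M = (i : Fin h) (j : Fin w) →
  lookup (lookup M (opposite i)) j ≡ lookup (lookup M i) j

VSym : {w h : ℕ} → Grid w h → Set
VSym {w} {h} M = (i : Fin h) (j : Fin w) →
  lookup (lookup M i) (opposite j) ≡ lookup (lookup M i) j

countTrue : {n : ℕ} → Vec Bool n → ℕ
countTrue [] = 0
countTrue (true ∷ v) = suc (countTrue v)
countTrue (false ∷ v) = countTrue v

area : {w h : ℕ} → Grid w h → ℕ
area [] = 0
area (r ∷ M) = countTrue r + area M

Poly : Set
Poly = Σ ℕ λ w → Σ ℕ λ h → Grid w h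

HVConvex : ℕ → ℕ → Poly → Set
HVConvex n a (w , h , M) =
  IsPolyomino M × Convex M × HSym M × VSym M × w + h ≡ n × area M ≡ a

-- Ferrers diagrams = integer partitions, as weakly decreasing lists of
-- positive parts.

_≥_ : ℕ → ℕ → Set
m ≥ n = n ≤ m

IsFerrers : List ℕ → Set
IsFerrers p = All (λ x → 1 ≤ x) p × Linked _≥_ p

NonEmptyList : List ℕ → Set
NonEmptyList p = 1 ≤ length p

largestPart : List ℕ → ℕ
largestPart [] = 0
largestPart (x ∷ _) = x

-- coefficient of t^n q^a in P(t², t², q⁴)
TermA : ℕ → ℕ → List ℕ → Set
TermA n a p = IsFerrers p × NonEmptyList p ×
  2 * largestPart p + 2 * length p ≡ n × 4 * sum p ≡ a

-- coefficient of t^n q^a in (1/t) P(t²/q², t², q⁴)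
TermB : ℕ → ℕ → List ℕ → Set
TermB n a p = IsFerrers p × NonEmptyList p ×
  2 * largestPart p + 2 * length p ≡ n + 1 ×
  4 * sum p ≡ a + 2 * largestPart p

-- coefficient of t^n q^a in (q/t²) P(t²/q², t²/q², q⁴)
TermC : ℕ → ℕ → List ℕ → Set
TermC n a p = IsFerrers p × NonEmptyList p ×
  2 * largestPart p + 2 * length p ≡ n + 2 ×
  4 * sum p + 1 ≡ a + 2 * largestPart p + 2 * length p

-- An hv-symmetric convex polyomino of width 2cw + bw and height 2ch + bh (bw, bh ∈ {0, 1}) is
-- determined by its quadrant, the cells at offset (r, c) from a central cell. Convexity and the two
-- symmetries make every row and column an interval symmetric about the centre, so the quadrant is a
-- Ferrers shape with X = cw + bw columns and Y = ch + bh rows; conversely, reflecting any Ferrers shape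
-- in both axes gives an hv-symmetric convex polyomino. In each parity class (bw, bh) this is a bijection
-- with nonempty partitions p, of half-perimeter 2X + 2Y - bw - bh and area 4|p| - 2bw·Y - 2bh·X + bw·bh.
-- The four classes give the three terms, the two mixed ones both the middle term (one after transposing p).

module Submission where

open import Defs
open import Data.Bool using (Bool; true; false; not)
open import Data.Bool.Properties using (not-involutive; T-≡; ¬-not)
open import Data.Empty using (⊥)
open import Data.Fin using (Fin; toℕ; fromℕ<; opposite) renaming (zero to fzero; suc to fsuc)
open import Data.Fin.Properties using (toℕ-fromℕ<; toℕ-injective; toℕ<n; opposite-prop)
open import Data.List using (List; []; _∷_; length; map; _++_; filter; deduplicate; cartesianProductWith; upTo; applyUpTo)
import Data.List.Properties as List
open import Data.List.Membership.Propositional using (_∈_)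
open import Data.List.Membership.Propositional.Properties
open import Data.List.Relation.Unary.All as All using (All; []; _∷_; all?)
import Data.List.Relation.Unary.All.Properties as All
open import Data.List.Relation.Unary.AllPairs using ([]; _∷_)
open import Data.List.Relation.Unary.Any using (here; there)
open import Data.List.Relation.Unary.Linked using (Linked; []; [-]; _∷_; linked?)
open import Data.List.Relation.Unary.Unique.Propositional using (Unique)
import Data.List.Relation.Unary.Unique.DecPropositional.Properties as Unique
import Data.List.Relation.Unary.Unique.Propositional.Properties as Unique
open import Data.Nat using (ℕ; zero; suc; _+_; _*_; _∸_; _≤_; _<_; s≤s; z≤n; _<ᵇ_; ⌊_/2⌋; _<?_; _≤?_; _≟_)
open import Data.Nat.ListAction using (sum)
open import Data.Nat.Properties
open import Data.Nat.Tactic.RingSolver using (solve-∀)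
open import Data.Product using (Σ; _×_; ∃; _,_; proj₁; proj₂)
open import Data.Product.Function.NonDependent.Propositional using (_×-⇔_)
open import Data.Sum using (_⊎_; inj₁; inj₂; [_,_]′)
open import Data.Vec using (Vec; []; _∷_; lookup; tabulate)
open import Data.Vec.Properties using (lookup∘tabulate; tabulate-cong; tabulate∘lookup)
open import Function using (_∘_; _∘′_; flip)
open import Function.Bundles using (_⇔_; mk⇔; Equivalence)
open import Function.Properties.Equivalence using () renaming (refl to ⇔-refl)
open import Relation.Binary.Definitions using (DecidableEquality)
open import Relation.Binary.PropositionalEquality
open import Relation.Nullary using (yes; no)
open import Relation.Nullary.Decidable using (_×-dec_)
open import Relation.Unary using (Decidable)
open import Algebra.Properties.CommutativeSemigroup +-commutativeSemigroup using (interchange)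

open Equivalence using (to; from)

IsCount-⇔ : {A : Set} {P Q : A → Set} → (∀ x → P x ⇔ Q x) → ∀ {k} → IsCount P k → IsCount Q k
IsCount-⇔ P⇔Q (L , unique , length≡ , mem) =
  L , unique , length≡ , λ x → mk⇔ (to (P⇔Q x) ∘′ to (mem x)) (from (mem x) ∘′ from (P⇔Q x))

module _ {A B : Set} {P : A → Set} (f : A → B) (injective : ∀ {x y} → P x → P y → f x ≡ f y → x ≡ y) where

  Unique-map⁺ : ∀ {L} → All P L → Unique L → Unique (map f L)
  Unique-map⁺ [] [] = []
  Unique-map⁺ (px ∷ pL) (x∉L ∷ unique) =
    All.map⁺ (All.zipWith (λ (py , x≢y) fx≡fy → x≢y (injective px py fx≡fy)) (pL , x∉L))
    ∷ Unique-map⁺ pL unique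

  IsCount-image : {Q : B → Set} → (∀ {x} → P x → Q (f x)) → (∀ {y} → Q y → ∃ λ x → P x × f x ≡ y) →
                  ∀ {k} → IsCount P k → IsCount Q k
  IsCount-image {Q} sound surjective (L , unique , length≡ , mem) =
    map f L ,
    Unique-map⁺ (All.tabulate (to (mem _))) unique ,
    trans (List.length-map f L) length≡ ,
    λ y → mk⇔ image⇒Q (Q⇒image y)
    where
    image⇒Q : ∀ {y} → y ∈ map f L → Q y
    image⇒Q y∈ with ∈-map⁻ f y∈
    ... | x , x∈L , refl = sound (to (mem x) x∈L)
    Q⇒image : ∀ y → Q y → y ∈ map f L
    Q⇒image y qy with surjective qy
    ... | x , px , refl = ∈-map⁺ f (from (mem x) px)

IsCount-⊎ : {A : Set} {P Q : A → Set} → (∀ {x} → P x → Q x → ⊥) →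
            ∀ {k l} → IsCount P k → IsCount Q l → IsCount (λ x → P x ⊎ Q x) (k + l)
IsCount-⊎ disjoint (L , uniqueL , lengthL , memL) (M , uniqueM , lengthM , memM) =
  L ++ M ,
  Unique.++⁺ uniqueL uniqueM (λ (x∈L , x∈M) → disjoint (to (memL _) x∈L) (to (memM _) x∈M)) ,
  trans (List.length-++ L) (cong₂ _+_ lengthL lengthM) ,
  λ x → mk⇔ ([ inj₁ ∘′ to (memL x) , inj₂ ∘′ to (memM x) ]′ ∘′ ∈-++⁻ L)
            [ ∈-++⁺ˡ ∘′ from (memL x) , ∈-++⁺ʳ L ∘′ from (memM x) ]′

IsCount-split : {A : Set} {P : A → Set} (label : A → Bool) →
                ∀ {k l} → IsCount (λ x → P x × label x ≡ false) k → IsCount (λ x → P x × label x ≡ true) l →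
                IsCount P (k + l)
IsCount-split {P = P} label countFalse countTrue =
  IsCount-⇔ (λ x → mk⇔ [ proj₁ , proj₁ ]′ (λ px → byLabel px (label x) refl))
    (IsCount-⊎ (λ (_ , ≡false) (_ , ≡true) → false≢true (trans (sym ≡false) ≡true)) countFalse countTrue)
  where
  false≢true : false ≡ true → ⊥
  false≢true ()
  byLabel : ∀ {x} → P x → ∀ b → label x ≡ b → (P x × label x ≡ false) ⊎ (P x × label x ≡ true)
  byLabel px false eq = inj₁ (px , eq)
  byLabel px true eq = inj₂ (px , eq)

IsCount-decidable : {A : Set} → DecidableEquality A → {P : A → Set} → Decidable P →
                    (candidates : List A) → (∀ {x} → P x → x ∈ candidates) → ∃ (IsCount P)
IsCount-decidable {A} _≟ᴬ_ P? candidates complete =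
  length L , L , Unique.deduplicate-! _≟ᴬ_ (filter P? candidates) , refl ,
  λ x → mk⇔ (proj₂ ∘′ ∈-filter⁻ P? {xs = candidates} ∘′ ∈-deduplicate⁻ _≟ᴬ_ (filter P? candidates))
            (λ px → ∈-deduplicate⁺ _≟ᴬ_ {xs = filter P? candidates} (∈-filter⁺ P? (complete px) px))
  where
  L : List A
  L = deduplicate _≟ᴬ_ (filter P? candidates)

-- Centred lines

bit : Bool → ℕ
bit false = 0
bit true = 1

bit≤1 : ∀ b → bit b ≤ 1
bit≤1 false = z≤n
bit≤1 true = ≤-refl

isOdd : ℕ → Bool
isOdd zero = false
isOdd (suc n) = not (isOdd n)

-- A line of span b c = 2c + bit b cells; centreDist b c i is the distance of cell i from its centre, the two
-- middle cells of an even line both being at distance 0, so the cells c + r have distance r.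
span : Bool → ℕ → ℕ
span b zero = bit b
span b (suc c) = suc (suc (span b c))

halfSpan : Bool → ℕ → ℕ
halfSpan b c = c + bit b

centreDist : Bool → ℕ → ℕ → ℕ
centreDist b zero i = i
centreDist b (suc c) zero = halfSpan b c
centreDist b (suc c) (suc i) = centreDist b c i

span≡c+halfSpan : ∀ b c → span b c ≡ c + halfSpan b c
span≡c+halfSpan b zero = refl
span≡c+halfSpan b (suc c) = cong suc (trans (cong suc (span≡c+halfSpan b c)) (sym (+-suc c (halfSpan b c))))

span+bit≡2*halfSpan : ∀ b c → span b c + bit b ≡ 2 * halfSpan b c
span+bit≡2*halfSpan b c = trans (cong (_+ bit b) (span≡c+halfSpan b c)) (arithmetic c (bit b))
  where
  arithmetic : ∀ c x → c + (c + x) + x ≡ 2 * (c + x)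
  arithmetic = solve-∀

isOdd-span : ∀ b c → isOdd (span b c) ≡ b
isOdd-span false zero = refl
isOdd-span true zero = refl
isOdd-span b (suc c) = trans (not-involutive (isOdd (span b c))) (isOdd-span b c)

⌊span/2⌋ : ∀ b c → ⌊ span b c /2⌋ ≡ c
⌊span/2⌋ false zero = refl
⌊span/2⌋ true zero = refl
⌊span/2⌋ b (suc c) = cong suc (⌊span/2⌋ b c)

span-isOdd-⌊/2⌋ : ∀ n → span (isOdd n) ⌊ n /2⌋ ≡ n
span-isOdd-⌊/2⌋ zero = refl
span-isOdd-⌊/2⌋ (suc zero) = refl
span-isOdd-⌊/2⌋ (suc (suc n)) rewrite not-involutive (isOdd n) = cong (suc ∘ suc) (span-isOdd-⌊/2⌋ n)

1≤halfSpan : ∀ b c → 0 < span b c → 1 ≤ halfSpan b c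
1≤halfSpan b zero 0<span = 0<span
1≤halfSpan b (suc c) _ = s≤s z≤n

c+r<span : ∀ b c {r} → r < halfSpan b c → c + r < span b c
c+r<span b c {r} r<X = subst (c + r <_) (sym (span≡c+halfSpan b c)) (+-monoʳ-< c r<X)

centreDist-+ : ∀ b c r → centreDist b c (c + r) ≡ r
centreDist-+ b zero r = refl
centreDist-+ b (suc c) r = centreDist-+ b c r

centreDist-span : ∀ b c → centreDist b c (span b c) ≡ halfSpan b c
centreDist-span b c = trans (cong (centreDist b c) (span≡c+halfSpan b c)) (centreDist-+ b c (halfSpan b c))

centreDist<halfSpan : ∀ b c {i} → i < span b c → centreDist b c i < halfSpan b c
centreDist<halfSpan true zero {zero} _ = s≤s z≤n
centreDist<halfSpan true zero {suc i} (s≤s ())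
centreDist<halfSpan b (suc c) {zero} _ = n<1+n _
centreDist<halfSpan b (suc c) {suc i} (s≤s i<) with m≤n⇒m<n∨m≡n i<
... | inj₁ (s≤s i<span) = m<n⇒m<1+n (centreDist<halfSpan b c i<span)
... | inj₂ refl = subst (_< suc (halfSpan b c)) (sym (centreDist-span b c)) (n<1+n _)

centreDist-reflect : ∀ b c {i} → i < span b c → centreDist b c (span b c ∸ suc i) ≡ centreDist b c i
centreDist-reflect true zero {zero} _ = refl
centreDist-reflect true zero {suc i} (s≤s ())
centreDist-reflect b (suc c) {zero} _ = centreDist-span b c
centreDist-reflect b (suc c) {suc i} (s≤s i<) with m≤n⇒m<n∨m≡n i<
... | inj₁ (s≤s i<span) =
  trans (cong (centreDist b (suc c)) (+-∸-assoc 1 i<span)) (centreDist-reflect b c i<span)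
... | inj₂ refl = trans (cong (centreDist b (suc c)) (n∸n≡0 (span b c))) (sym (centreDist-span b c))

centreDist-mirror : ∀ b c {i} → i < span b c →
  i ≡ c + centreDist b c i ⊎ span b c ∸ suc i ≡ c + centreDist b c i
centreDist-mirror true zero {zero} _ = inj₁ refl
centreDist-mirror true zero {suc i} (s≤s ())
centreDist-mirror b (suc c) {zero} _ = inj₂ (cong suc (span≡c+halfSpan b c))
centreDist-mirror b (suc c) {suc i} (s≤s i<) with m≤n⇒m<n∨m≡n i<
... | inj₂ refl = inj₁ (cong suc (trans (span≡c+halfSpan b c) (cong (c +_) (sym (centreDist-span b c)))))
... | inj₁ (s≤s i<span) with centreDist-mirror b c i<span
...   | inj₁ i≡ = inj₁ (cong suc i≡)
...   | inj₂ i′≡ = inj₂ (trans (+-∸-assoc 1 i<span) (cong suc i′≡))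

centreDist≤⇒between : ∀ b c {i d} → centreDist b c i ≤ d → span b c ≤ suc (c + d + i) × i ≤ c + d
centreDist≤⇒between b zero {i} {d} i≤d = ≤-trans (bit≤1 b) (s≤s z≤n) , i≤d
centreDist≤⇒between b (suc c) {zero} {d} X≤d =
  s≤s (s≤s (subst (_≤ _) (sym (span≡c+halfSpan b c)) (≤-trans (+-monoʳ-≤ c X≤d) (m≤m+n (c + d) 0)))) ,
  z≤n
centreDist≤⇒between b (suc c) {suc i} {d} dist≤d with centreDist≤⇒between b c dist≤d
... | lower , upper = s≤s (s≤s (≤-trans lower (≤-reflexive (sym (+-suc (c + d) i))))) , s≤s upper

centreDist-antitone : ∀ b c {j k} → j ≤ k → k < c → centreDist b c k ≤ centreDist b c j
centreDist-antitone b (suc c) {zero} {zero} _ _ = ≤-refl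
centreDist-antitone b (suc c) {zero} {suc k} _ (s≤s k<c) =
  <⇒≤ (centreDist<halfSpan b c (<-≤-trans k<c (subst (c ≤_) (sym (span≡c+halfSpan b c)) (m≤m+n c _))))
centreDist-antitone b (suc c) {suc j} {suc k} (s≤s j≤k) (s≤s k<c) = centreDist-antitone b c j≤k k<c

centreDist-monotone : ∀ b c {k l} → c ≤ k → k ≤ l → centreDist b c k ≤ centreDist b c l
centreDist-monotone b c c≤k k≤l with m≤n⇒∃[o]m+o≡n c≤k | m≤n⇒∃[o]m+o≡n (≤-trans c≤k k≤l)
... | r , refl | r′ , refl =
  subst₂ _≤_ (sym (centreDist-+ b c r)) (sym (centreDist-+ b c r′)) (+-cancelˡ-≤ c r r′ k≤l)

centreDist-convex : ∀ b c {j k l} → j ≤ k → k ≤ l →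
  centreDist b c k ≤ centreDist b c j ⊎ centreDist b c k ≤ centreDist b c l
centreDist-convex b c {k = k} j≤k k≤l with k <? c
... | yes k<c = inj₁ (centreDist-antitone b c j≤k k<c)
... | no k≮c = inj₂ (centreDist-monotone b c (≮⇒≥ k≮c) k≤l)

sumTo : ℕ → (ℕ → ℕ) → ℕ
sumTo zero f = 0
sumTo (suc n) f = f 0 + sumTo n (f ∘ suc)

count : ℕ → (ℕ → Bool) → ℕ
count n f = sumTo n (bit ∘ f)

sumTo-suc : ∀ n f → sumTo (suc n) f ≡ sumTo n f + f n
sumTo-suc zero f = +-comm (f 0) 0
sumTo-suc (suc n) f = trans (cong (f 0 +_) (sumTo-suc n (f ∘ suc))) (sym (+-assoc (f 0) _ _))

sumTo-cong : ∀ n {f g} → (∀ {i} → i < n → f i ≡ g i) → sumTo n f ≡ sumTo n g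
sumTo-cong zero f≗g = refl
sumTo-cong (suc n) f≗g = cong₂ _+_ (f≗g (s≤s z≤n)) (sumTo-cong n (f≗g ∘ s≤s))

sumTo-+ : ∀ n f g → sumTo n (λ i → f i + g i) ≡ sumTo n f + sumTo n g
sumTo-+ zero f g = refl
sumTo-+ (suc n) f g =
  trans (cong (f 0 + g 0 +_) (sumTo-+ n (f ∘ suc) (g ∘ suc))) (interchange (f 0) (g 0) _ _)

sumTo-const : ∀ n k → sumTo n (λ _ → k) ≡ n * k
sumTo-const zero k = refl
sumTo-const (suc n) k = cong (k +_) (sumTo-const n k)

sumTo-*ˡ : ∀ n k f → sumTo n (λ i → k * f i) ≡ k * sumTo n f
sumTo-*ˡ zero k f = sym (*-zeroʳ k)
sumTo-*ˡ (suc n) k f = trans (cong (k * f 0 +_) (sumTo-*ˡ n k (f ∘ suc))) (sym (*-distribˡ-+ k (f 0) _))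

sumTo-swap : ∀ m n (f : ℕ → ℕ → ℕ) → sumTo m (λ i → sumTo n (f i)) ≡ sumTo n (λ j → sumTo m (λ i → f i j))
sumTo-swap zero n f = sym (trans (sumTo-const n 0) (*-zeroʳ n))
sumTo-swap (suc m) n f =
  trans (cong (sumTo n (f 0) +_) (sumTo-swap m n (f ∘ suc)))
        (sym (sumTo-+ n (f 0) (λ j → sumTo m (λ i → f (suc i) j))))

-- Summing over a symmetric line counts every distance twice, except the centre of an odd line.
sumTo-centreDist : ∀ b c F → sumTo (span b c) (F ∘ centreDist b c) + bit b * F 0 ≡ 2 * sumTo (halfSpan b c) F
sumTo-centreDist false zero F = refl
sumTo-centreDist true zero F = arithmetic (F 0)
  where
  arithmetic : ∀ x → x + 0 + 1 * x ≡ 2 * (x + 0)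
  arithmetic = solve-∀
sumTo-centreDist b (suc c) F = begin
  F X + sumTo (suc (span b c)) (F ∘ centreDist b c) + bit b * F 0
    ≡⟨ cong (λ s → F X + s + bit b * F 0) (sumTo-suc (span b c) (F ∘ centreDist b c)) ⟩
  F X + (T + F (centreDist b c (span b c))) + bit b * F 0
    ≡⟨ cong (λ d → F X + (T + F d) + bit b * F 0) (centreDist-span b c) ⟩
  F X + (T + F X) + bit b * F 0
    ≡⟨ arithmetic (F X) T (bit b * F 0) ⟩
  2 * F X + (T + bit b * F 0)
    ≡⟨ cong (2 * F X +_) (sumTo-centreDist b c F) ⟩
  2 * F X + 2 * sumTo X F
    ≡⟨ sym (*-distribˡ-+ 2 (F X) (sumTo X F)) ⟩
  2 * (F X + sumTo X F)
    ≡⟨ cong (2 *_) (trans (+-comm (F X) _) (sym (sumTo-suc X F))) ⟩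
  2 * sumTo (suc X) F ∎
  where
  open ≡-Reasoning
  X T : ℕ
  X = halfSpan b c
  T = sumTo (span b c) (F ∘ centreDist b c)
  arithmetic : ∀ x t e → x + (t + x) + e ≡ 2 * x + (t + e)
  arithmetic = solve-∀

count-all : ∀ n {f} → (∀ {i} → i < n → f i ≡ true) → count n f ≡ n
count-all zero all = refl
count-all (suc n) all rewrite all (s≤s z≤n) = cong suc (count-all n (all ∘ s≤s))

count-positive : ∀ n {f} → 1 ≤ n → f 0 ≡ true → 1 ≤ count n f
count-positive (suc n) _ f0≡true rewrite f0≡true = s≤s z≤n

count-none : ∀ n {f} → (∀ i → f i ≡ false) → count n f ≡ 0
count-none zero none = refl
count-none (suc n) {f} none rewrite none 0 = count-none n (none ∘ suc)

count-<ᵇ : ∀ n {x} → x ≤ n → count n (_<ᵇ x) ≡ x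
count-<ᵇ n {zero} _ = count-none n (λ _ → refl)
count-<ᵇ (suc n) {suc x} (s≤s x≤n) = cong suc (count-<ᵇ n x≤n)

count-mono : ∀ n {f g} → (∀ {i} → f i ≡ true → g i ≡ true) → count n f ≤ count n g
count-mono zero f⇒g = z≤n
count-mono (suc n) {f} {g} f⇒g = +-mono-≤ (bit-mono (f 0) (g 0) f⇒g) (count-mono n f⇒g)
  where
  bit-mono : ∀ x y → (x ≡ true → y ≡ true) → bit x ≤ bit y
  bit-mono false y _ = z≤n
  bit-mono true y x⇒y rewrite x⇒y refl = ≤-refl

count-initialSegment : ∀ n {f} → (∀ {c c′} → c′ ≤ c → f c ≡ true → f c′ ≡ true) →
  (∀ {c} → n ≤ c → f c ≡ false) → ∀ c → f c ≡ (c <ᵇ count n f)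
count-initialSegment zero downClosed vanishing c = vanishing z≤n
count-initialSegment (suc n) {f} downClosed vanishing c with f 0 in f0
count-initialSegment (suc n) {f} downClosed vanishing zero | true = f0
count-initialSegment (suc n) {f} downClosed vanishing (suc c) | true =
  count-initialSegment n (λ c′≤c → downClosed (s≤s c′≤c)) (vanishing ∘ s≤s) c
... | false = trans (none c) (cong (c <ᵇ_) (sym (count-none n (none ∘ suc))))
  where
  none : ∀ c → f c ≡ false
  none c with f c in fc
  ... | false = refl
  ... | true = trans (sym (downClosed z≤n fc)) f0

grid : (w h : ℕ) → (ℕ → ℕ → Bool) → Grid w h
grid w h g = tabulate λ i → tabulate λ j → g (toℕ i) (toℕ j)

lookup-grid : ∀ {w h} g (i : Fin h) (j : Fin w) → lookup (lookup (grid w h g) i) j ≡ g (toℕ i) (toℕ j)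
lookup-grid g i j =
  trans (cong (λ row → lookup row j) (lookup∘tabulate _ i)) (lookup∘tabulate (λ j → g (toℕ i) (toℕ j)) j)

grid-ext : ∀ {w h} g (M : Grid w h) → (∀ i j → g (toℕ i) (toℕ j) ≡ lookup (lookup M i) j) → grid w h g ≡ M
grid-ext g M g≗M =
  trans (tabulate-cong λ i → trans (tabulate-cong (g≗M i)) (tabulate∘lookup (lookup M i))) (tabulate∘lookup M)

countTrue-tabulate : ∀ n f → countTrue (tabulate {n = n} (f ∘ toℕ)) ≡ count n f
countTrue-tabulate zero f = refl
countTrue-tabulate (suc n) f with f 0
... | true = cong suc (countTrue-tabulate n (f ∘ suc))
... | false = countTrue-tabulate n (f ∘ suc)

area-grid : ∀ w h g → area (grid w h g) ≡ sumTo h (λ r → count w (g r))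
area-grid w zero g = refl
area-grid w (suc h) g =
  cong₂ _+_ (countTrue-tabulate w (g 0)) (area-grid w h (g ∘ suc))

entryAt : ∀ {n} → Vec Bool n → ℕ → Bool
entryAt [] c = false
entryAt (x ∷ v) zero = x
entryAt (x ∷ v) (suc c) = entryAt v c

-- Cell lookup by natural-number coordinates, false outside the grid.
cellAt : ∀ {w h} → Grid w h → ℕ → ℕ → Bool
cellAt [] r c = false
cellAt (row ∷ M) zero c = entryAt row c
cellAt (row ∷ M) (suc r) c = cellAt M r c

cellAt-lookup : ∀ {w h} (M : Grid w h) i j → cellAt M (toℕ i) (toℕ j) ≡ lookup (lookup M i) j
cellAt-lookup (row ∷ M) fzero j = entryAt-lookup row j
  where
  entryAt-lookup : ∀ {n} (v : Vec Bool n) j → entryAt v (toℕ j) ≡ lookup v j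
  entryAt-lookup (x ∷ v) fzero = refl
  entryAt-lookup (x ∷ v) (fsuc j) = entryAt-lookup v j
cellAt-lookup (row ∷ M) (fsuc i) j = cellAt-lookup M i j

cellAt-fromℕ< : ∀ {w h} (M : Grid w h) {r c} (r<h : r < h) (c<w : c < w) →
  cellAt M r c ≡ lookup (lookup M (fromℕ< r<h)) (fromℕ< c<w)
cellAt-fromℕ< M r<h c<w =
  trans (sym (cong₂ (cellAt M) (toℕ-fromℕ< r<h) (toℕ-fromℕ< c<w))) (cellAt-lookup M _ _)

cellAt-true : ∀ {w h} (M : Grid w h) r c → cellAt M r c ≡ true →
  ∃ λ i → ∃ λ j → toℕ i ≡ r × toℕ j ≡ c × Filled M (i , j)
cellAt-true (row ∷ M) zero c filled with entryAt-true row c filled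
  where
  entryAt-true : ∀ {n} (v : Vec Bool n) c → entryAt v c ≡ true → ∃ λ j → toℕ j ≡ c × lookup v j ≡ true
  entryAt-true (x ∷ v) zero e = fzero , refl , e
  entryAt-true (x ∷ v) (suc c) e with entryAt-true v c e
  ... | j , refl , e′ = fsuc j , refl , e′
... | j , j≡c , e = fzero , j , refl , j≡c , e
cellAt-true (row ∷ M) (suc r) c filled with cellAt-true M r c filled
... | i , j , refl , j≡c , e = fsuc i , j , refl , j≡c , e

cellAt-grid : ∀ {w h} g {r c} → r < h → c < w → cellAt (grid w h g) r c ≡ g r c
cellAt-grid g r<h c<w =
  trans (cellAt-fromℕ< (grid _ _ g) r<h c<w)
        (trans (lookup-grid g _ _) (cong₂ g (toℕ-fromℕ< r<h) (toℕ-fromℕ< c<w)))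

module _ {w h} {M : Grid w h} where

  _++ₚ_ : ∀ {c d e} → Path M c d → Path M d e → Path M c e
  here _ ++ₚ q = q
  step filled adj p ++ₚ q = step filled adj (p ++ₚ q)

  Adj-sym : ∀ {c d : Cell w h} → Adj c d → Adj d c
  Adj-sym (inj₁ (refl , inj₁ e)) = inj₁ (refl , inj₂ e)
  Adj-sym (inj₁ (refl , inj₂ e)) = inj₁ (refl , inj₁ e)
  Adj-sym (inj₂ (refl , inj₁ e)) = inj₂ (refl , inj₂ e)
  Adj-sym (inj₂ (refl , inj₂ e)) = inj₂ (refl , inj₁ e)

  _∷ʳₚ_ : ∀ {c d e} → Path M c d → Adj d e × Filled M e → Path M c e
  here filled ∷ʳₚ (adj , filled′) = step filled adj (here filled′)
  step filled adj p ∷ʳₚ last = step filled adj (p ∷ʳₚ last)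

  reverseₚ : ∀ {c d} → Path M c d → Path M d c
  reverseₚ (here filled) = here filled
  reverseₚ (step filled adj p) = reverseₚ p ∷ʳₚ (Adj-sym adj , filled)

LineConvex : ∀ {n} → (Fin n → Set) → Set
LineConvex F = ∀ j k l → toℕ j ≤ toℕ k → toℕ k ≤ toℕ l → F j → F l → F k

module _ {w h n} {M : Grid w h} (cell : Fin n → Cell w h)
         (adjacent : ∀ {k l} → suc (toℕ k) ≡ toℕ l → Adj (cell k) (cell l)) where

  path-along : ∀ d j l → toℕ l ≡ d + toℕ j →
    (∀ k → toℕ j ≤ toℕ k → toℕ k ≤ toℕ l → Filled M (cell k)) → Path M (cell j) (cell l)
  path-along zero j l l≡j filled with toℕ-injective l≡j
  ... | refl = here (filled j ≤-refl ≤-refl)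
  path-along (suc d) j l l≡d+1+j filled =
    step (filled j ≤-refl j≤l) (adjacent (sym (toℕ-fromℕ< 1+j<n)))
         (path-along d next l l≡d+next
           (λ k next≤k → filled k (≤-trans (n≤1+n _) (subst (_≤ toℕ k) (toℕ-fromℕ< 1+j<n) next≤k))))
    where
    j≤l : toℕ j ≤ toℕ l
    j≤l = subst (toℕ j ≤_) (sym l≡d+1+j) (m≤n+m (toℕ j) (suc d))
    1+j<n : suc (toℕ j) < n
    1+j<n = ≤-<-trans (subst (suc (toℕ j) ≤_) (trans (+-suc d (toℕ j)) (sym l≡d+1+j)) (m≤n+m _ d)) (toℕ<n l)
    next : Fin n
    next = fromℕ< 1+j<n
    l≡d+next : toℕ l ≡ d + toℕ next
    l≡d+next = trans l≡d+1+j (trans (sym (+-suc d (toℕ j))) (cong (d +_) (sym (toℕ-fromℕ< 1+j<n))))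

  path-in-line : LineConvex (Filled M ∘ cell) →
    ∀ j l → Filled M (cell j) → Filled M (cell l) → Path M (cell j) (cell l)
  path-in-line convex j l filledj filledl with ≤-total (toℕ j) (toℕ l)
  ... | inj₁ j≤l with m≤n⇒∃[o]m+o≡n j≤l
  ...   | d , j+d≡l = path-along d j l (trans (sym j+d≡l) (+-comm (toℕ j) d))
                        (λ k j≤k k≤l → convex j k l j≤k k≤l filledj filledl)
  path-in-line convex j l filledj filledl | inj₂ l≤j with m≤n⇒∃[o]m+o≡n l≤j
  ...   | d , l+d≡j = reverseₚ (path-along d l j (trans (sym l+d≡j) (+-comm (toℕ l) d))
                                   (λ k l≤k k≤j → convex l k j l≤k k≤j filledl filledj))

connected-via-column : ∀ {w h} (M : Grid w h) → Convex M → (centre : Fin w) →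
  (∀ {i j} → Filled M (i , j) → Filled M (i , centre)) → EdgeConnected M
connected-via-column M (rowConvex , columnConvex) centre toCentre (i , j) (i′ , j′) filled filled′ =
  row i j centre filled (toCentre filled)
  ++ₚ (column centre i i′ (toCentre filled) (toCentre filled′)
  ++ₚ row i′ centre j′ (toCentre filled′) filled′)
  where
  row : ∀ i j l → Filled M (i , j) → Filled M (i , l) → Path M (i , j) (i , l)
  row i = path-in-line (i ,_) (λ e → inj₁ (refl , inj₁ e)) (rowConvex i)
  column : ∀ j i l → Filled M (i , j) → Filled M (l , j) → Path M (i , j) (l , j)
  column j = path-in-line (_, j) (λ e → inj₂ (refl , inj₁ e)) (columnConvex j)

-- Ferrers shapes and their symmetric unfoldings

record FerrersShape (Q : ℕ → ℕ → Bool) (X Y : ℕ) : Set where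
  field
    downClosed : ∀ {r c r′ c′} → r′ ≤ r → c′ ≤ c → Q r c ≡ true → Q r′ c′ ≡ true
    firstRow : ∀ {c} → c < X → Q 0 c ≡ true
    firstColumn : ∀ {r} → r < Y → Q r 0 ≡ true
    bounded : ∀ {r c} → Q r c ≡ true → r < Y × c < X

FerrersShape-transpose : ∀ {Q X Y} → FerrersShape Q X Y → FerrersShape (flip Q) Y X
FerrersShape-transpose shape = record
  { downClosed = λ r′≤r c′≤c → downClosed c′≤c r′≤r
  ; firstRow = firstColumn
  ; firstColumn = firstRow
  ; bounded = λ filled → let (r<Y , c<X) = bounded filled in c<X , r<Y
  }
  where open FerrersShape shape

shapeSize : (ℕ → ℕ → Bool) → ℕ → ℕ → ℕ
shapeSize Q X Y = sumTo Y (λ r → count X (Q r))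

shapeSize-transpose : ∀ Q X Y → shapeSize (flip Q) Y X ≡ shapeSize Q X Y
shapeSize-transpose Q X Y = sumTo-swap X Y (λ c r → bit (Q r c))

Palindromic : ∀ {n} → (Fin n → Bool) → Set
Palindromic f = ∀ k → f (opposite k) ≡ f k

module _ (b : Bool) (c : ℕ) (f : Fin (span b c) → Bool) (palindromic : Palindromic f) where

  palindromic-mirror : ∀ k → ∃ λ k′ → toℕ k′ ≡ c + centreDist b c (toℕ k) × f k′ ≡ f k
  palindromic-mirror k with centreDist-mirror b c (toℕ<n k)
  ... | inj₁ k≡ = k , k≡ , refl
  ... | inj₂ k′≡ = opposite k , trans (opposite-prop k) k′≡ , palindromic k

  fill-towardsCentre : LineConvex (λ k → f k ≡ true) →
    ∀ {j k} → centreDist b c (toℕ k) ≤ centreDist b c (toℕ j) → f j ≡ true → f k ≡ true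
  fill-towardsCentre convex {j} {k} closer fj
    with palindromic-mirror j | centreDist≤⇒between b c closer
  ... | j′ , j′≡ , fj′≡fj | span≤ , k≤ =
    convex (opposite j′) k j′ lower upper (trans (palindromic j′) fj′) fj′
    where
    fj′ : f j′ ≡ true
    fj′ = trans fj′≡fj fj
    upper : toℕ k ≤ toℕ j′
    upper = subst (toℕ k ≤_) (sym j′≡) k≤
    lower : toℕ (opposite j′) ≤ toℕ k
    lower = subst (_≤ toℕ k) (sym (trans (opposite-prop j′) (cong (λ x → span b c ∸ suc x) j′≡)))
                  (m≤n+o⇒m∸n≤o (span b c) _ span≤)

centre : ∀ b c → 1 ≤ halfSpan b c → Fin (span b c)
centre b c 1≤X = fromℕ< (c+r<span b c 1≤X)

centreDist-centre : ∀ b c (1≤X : 1 ≤ halfSpan b c) → centreDist b c (toℕ (centre b c 1≤X)) ≡ 0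
centreDist-centre b c 1≤X = trans (cong (centreDist b c) (toℕ-fromℕ< (c+r<span b c 1≤X))) (centreDist-+ b c 0)

quadrant : ∀ {w h} → ℕ → ℕ → Grid w h → ℕ → ℕ → Bool
quadrant cw ch M r c = cellAt M (ch + r) (cw + c)

module Unfolding (bw : Bool) (cw : ℕ) (bh : Bool) (ch : ℕ) where

  W H X Y : ℕ
  W = span bw cw
  H = span bh ch
  X = halfSpan bw cw
  Y = halfSpan bh ch

  unfold : (ℕ → ℕ → Bool) → Grid W H
  unfold Q = grid W H λ i j → Q (centreDist bh ch i) (centreDist bw cw j)

  module _ (Q : ℕ → ℕ → Bool) where

    lookup-unfold : ∀ i j → lookup (lookup (unfold Q) i) j ≡ Q (centreDist bh ch (toℕ i)) (centreDist bw cw (toℕ j))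
    lookup-unfold = lookup-grid (λ r c → Q (centreDist bh ch r) (centreDist bw cw c))

    unfold-hsym : HSym (unfold Q)
    unfold-hsym i j = begin
      lookup (lookup (unfold Q) (opposite i)) j ≡⟨ lookup-unfold (opposite i) j ⟩
      Q (centreDist bh ch (toℕ (opposite i))) _ ≡⟨ cong (λ r → Q (centreDist bh ch r) _) (opposite-prop i) ⟩
      Q (centreDist bh ch (H ∸ suc (toℕ i))) _ ≡⟨ cong (λ r → Q r _) (centreDist-reflect bh ch (toℕ<n i)) ⟩
      Q (centreDist bh ch (toℕ i)) _            ≡⟨ lookup-unfold i j ⟨
      lookup (lookup (unfold Q) i) j            ∎
      where open ≡-Reasoning

    unfold-vsym : VSym (unfold Q)
    unfold-vsym i j = begin
      lookup (lookup (unfold Q) i) (opposite j) ≡⟨ lookup-unfold i (opposite j) ⟩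
      Q _ (centreDist bw cw (toℕ (opposite j))) ≡⟨ cong (λ c → Q _ (centreDist bw cw c)) (opposite-prop j) ⟩
      Q _ (centreDist bw cw (W ∸ suc (toℕ j))) ≡⟨ cong (Q _) (centreDist-reflect bw cw (toℕ<n j)) ⟩
      Q _ (centreDist bw cw (toℕ j))            ≡⟨ lookup-unfold i j ⟨
      lookup (lookup (unfold Q) i) j            ∎
      where open ≡-Reasoning

  module _ {Q : ℕ → ℕ → Bool} (shape : FerrersShape Q X Y) where
    open FerrersShape shape

    unfold-filled⁺ : ∀ {i j} → Q (centreDist bh ch (toℕ i)) (centreDist bw cw (toℕ j)) ≡ true → Filled (unfold Q) (i , j)
    unfold-filled⁺ {i} {j} = trans (lookup-unfold Q i j)

    unfold-filled⁻ : ∀ {i j} → Filled (unfold Q) (i , j) → Q (centreDist bh ch (toℕ i)) (centreDist bw cw (toℕ j)) ≡ true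
    unfold-filled⁻ {i} {j} = trans (sym (lookup-unfold Q i j))

    unfold-convex : Convex (unfold Q)
    unfold-convex = rowConvex , columnConvex
      where
      rowConvex : ∀ i → LineConvex (λ j → Filled (unfold Q) (i , j))
      rowConvex i j k l j≤k k≤l filledj filledl with centreDist-convex bw cw j≤k k≤l
      ... | inj₁ k≤j = unfold-filled⁺ (downClosed ≤-refl k≤j (unfold-filled⁻ filledj))
      ... | inj₂ k≤l = unfold-filled⁺ (downClosed ≤-refl k≤l (unfold-filled⁻ filledl))
      columnConvex : ∀ j → LineConvex (λ i → Filled (unfold Q) (i , j))
      columnConvex j i k l i≤k k≤l filledi filledl with centreDist-convex bh ch i≤k k≤l
      ... | inj₁ k≤i = unfold-filled⁺ (downClosed k≤i ≤-refl (unfold-filled⁻ filledi))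
      ... | inj₂ k≤l = unfold-filled⁺ (downClosed k≤l ≤-refl (unfold-filled⁻ filledl))

    unfold-polyomino : (1≤X : 1 ≤ X) (1≤Y : 1 ≤ Y) → IsPolyomino (unfold Q)
    unfold-polyomino 1≤X 1≤Y =
      ((ic , jc) , inCentreRow (subst (λ c → Q 0 c ≡ true) (sym (centreDist-centre bw cw 1≤X)) (firstRow 1≤X))) ,
      connected-via-column (unfold Q) unfold-convex jc (λ filled → inCentreColumn (downClosed ≤-refl z≤n (unfold-filled⁻ filled))) ,
      (λ i → jc , inCentreColumn (firstColumn (centreDist<halfSpan bh ch (toℕ<n i)))) ,
      (λ j → ic , inCentreRow (firstRow (centreDist<halfSpan bw cw (toℕ<n j))))
      where
      ic : Fin H
      ic = centre bh ch 1≤Y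
      jc : Fin W
      jc = centre bw cw 1≤X
      inCentreColumn : ∀ {i} → Q (centreDist bh ch (toℕ i)) 0 ≡ true → Filled (unfold Q) (i , jc)
      inCentreColumn {i} =
        unfold-filled⁺ ∘ subst (λ c → Q (centreDist bh ch (toℕ i)) c ≡ true) (sym (centreDist-centre bw cw 1≤X))
      inCentreRow : ∀ {j} → Q 0 (centreDist bw cw (toℕ j)) ≡ true → Filled (unfold Q) (ic , j)
      inCentreRow {j} =
        unfold-filled⁺ ∘ subst (λ r → Q r (centreDist bw cw (toℕ j)) ≡ true) (sym (centreDist-centre bh ch 1≤Y))

    private
      rowSize : ℕ → ℕ
      rowSize r = count X (Q r)

    count-unfold-row : ∀ {r} → r < Y → count W (Q r ∘ centreDist bw cw) + bit bw ≡ 2 * rowSize r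
    count-unfold-row {r} r<Y =
      trans (cong (count W (Q r ∘ centreDist bw cw) +_) bit≡) (sumTo-centreDist bw cw (bit ∘ Q r))
      where
      bit≡ : bit bw ≡ bit bw * bit (Q r 0)
      bit≡ = sym (trans (cong (λ x → bit bw * bit x) (firstColumn r<Y)) (*-identityʳ (bit bw)))

    area-unfold-rows : area (unfold Q) + H * bit bw ≡ 2 * sumTo H (rowSize ∘ centreDist bh ch)
    area-unfold-rows = begin
      area (unfold Q) + H * bit bw
        ≡⟨ cong₂ _+_ (area-grid W H _) (sym (sumTo-const H (bit bw))) ⟩
      sumTo H (λ i → count W (Q (centreDist bh ch i) ∘ centreDist bw cw)) + sumTo H (λ _ → bit bw)
        ≡⟨ sumTo-+ H _ _ ⟨
      sumTo H (λ i → count W (Q (centreDist bh ch i) ∘ centreDist bw cw) + bit bw)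
        ≡⟨ sumTo-cong H (λ i<H → count-unfold-row (centreDist<halfSpan bh ch i<H)) ⟩
      sumTo H (λ i → 2 * rowSize (centreDist bh ch i))
        ≡⟨ sumTo-*ˡ H 2 _ ⟩
      2 * sumTo H (rowSize ∘ centreDist bh ch) ∎
      where open ≡-Reasoning

    -- Four copies of the quadrant cover the polyomino, with its central column and row counted twice.
    area-unfold : area (unfold Q) + (bit bw * (2 * Y) + bit bh * (2 * X)) ≡ 4 * shapeSize Q X Y + bit bw * bit bh
    area-unfold = begin
      A + (bit bw * (2 * Y) + bit bh * (2 * X))
        ≡⟨ cong (λ y → A + (bit bw * y + bit bh * (2 * X))) (span+bit≡2*halfSpan bh ch) ⟨
      A + (bit bw * (H + bit bh) + bit bh * (2 * X))
        ≡⟨ regroup A H (bit bw) (bit bh) X ⟩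
      (A + H * bit bw) + 2 * (bit bh * X) + bit bw * bit bh
        ≡⟨ cong (λ a → a + 2 * (bit bh * X) + bit bw * bit bh) area-unfold-rows ⟩
      2 * T + 2 * (bit bh * X) + bit bw * bit bh
        ≡⟨ cong (_+ bit bw * bit bh) (*-distribˡ-+ 2 T (bit bh * X)) ⟨
      2 * (T + bit bh * X) + bit bw * bit bh
        ≡⟨ cong (λ x → 2 * (T + bit bh * x) + bit bw * bit bh) (count-all X firstRow) ⟨
      2 * (T + bit bh * rowSize 0) + bit bw * bit bh
        ≡⟨ cong (λ t → 2 * t + bit bw * bit bh) (sumTo-centreDist bh ch rowSize) ⟩
      2 * (2 * shapeSize Q X Y) + bit bw * bit bh
        ≡⟨ cong (_+ bit bw * bit bh) (*-assoc 2 2 (shapeSize Q X Y)) ⟨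
      4 * shapeSize Q X Y + bit bw * bit bh ∎
      where
      open ≡-Reasoning
      A T : ℕ
      A = area (unfold Q)
      T = sumTo H (rowSize ∘ centreDist bh ch)
      regroup : ∀ a h v u x → a + (v * (h + u) + u * (2 * x)) ≡ (a + h * v) + 2 * (u * x) + v * u
      regroup = solve-∀

  unfold-cong : ∀ {Q Q′} → (∀ r c → Q r c ≡ Q′ r c) → unfold Q ≡ unfold Q′
  unfold-cong {Q} {Q′} Q≗Q′ =
    grid-ext (λ r c → Q (centreDist bh ch r) (centreDist bw cw c)) (unfold Q′)
             (λ i j → trans (Q≗Q′ _ _) (sym (lookup-unfold Q′ i j)))

  quadrant-unfold : ∀ Q {r c} → r < Y → c < X → quadrant cw ch (unfold Q) r c ≡ Q r c
  quadrant-unfold Q r<Y c<X =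
    trans (cellAt-grid (λ r c → Q (centreDist bh ch r) (centreDist bw cw c)) (c+r<span bh ch r<Y) (c+r<span bw cw c<X))
          (cong₂ Q (centreDist-+ bh ch _) (centreDist-+ bw cw _))

  module _ (M : Grid W H) (hsym : HSym M) (vsym : VSym M) where

    unfold-quadrant : unfold (quadrant cw ch M) ≡ M
    unfold-quadrant = grid-ext (λ r c → quadrant cw ch M (centreDist bh ch r) (centreDist bw cw c)) M λ i j →
      let (j′ , j′≡ , Mij′≡Mij) = palindromic-mirror bw cw (lookup (lookup M i)) (vsym i) j
          (i′ , i′≡ , Mi′j′≡Mij′) = palindromic-mirror bh ch (λ i → lookup (lookup M i) j′) (λ i → hsym i j′) i
      in begin
        cellAt M (ch + centreDist bh ch (toℕ i)) (cw + centreDist bw cw (toℕ j)) ≡⟨ cong₂ (cellAt M) i′≡ j′≡ ⟨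
        cellAt M (toℕ i′) (toℕ j′)                                                 ≡⟨ cellAt-lookup M i′ j′ ⟩
        lookup (lookup M i′) j′                                                    ≡⟨ Mi′j′≡Mij′ ⟩
        lookup (lookup M i) j′                                                     ≡⟨ Mij′≡Mij ⟩
        lookup (lookup M i) j                                                      ∎
      where open ≡-Reasoning

    module _ (convex : Convex M) where

      fill-towardsCentre-row : ∀ {i j k} → centreDist bw cw (toℕ k) ≤ centreDist bw cw (toℕ j) →
        Filled M (i , j) → Filled M (i , k)
      fill-towardsCentre-row {i} = fill-towardsCentre bw cw (lookup (lookup M i)) (vsym i) (proj₁ convex i)

      fill-towardsCentre-column : ∀ {i j k} → centreDist bh ch (toℕ k) ≤ centreDist bh ch (toℕ i) →
        Filled M (i , j) → Filled M (k , j)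
      fill-towardsCentre-column {j = j} =
        fill-towardsCentre bh ch (λ i → lookup (lookup M i) j) (λ i → hsym i j) (proj₂ convex j)

      quadrant-shape : Tight M → 1 ≤ X → 1 ≤ Y → FerrersShape (quadrant cw ch M) X Y
      quadrant-shape (rowsMet , columnsMet) 1≤X 1≤Y = record
        { downClosed = downClosed
        ; firstRow = λ c<X → let (i , Mij) = columnsMet (fromℕ< (c+r<span bw cw c<X)) in
            trans (cellAt-fromℕ< M (c+r<span bh ch 1≤Y) (c+r<span bw cw c<X))
                  (fill-towardsCentre-column (subst (_≤ centreDist bh ch (toℕ i)) (sym (centreDist-centre bh ch 1≤Y)) z≤n) Mij)
        ; firstColumn = λ r<Y → let (j , Mij) = rowsMet (fromℕ< (c+r<span bh ch r<Y)) in
            trans (cellAt-fromℕ< M (c+r<span bh ch r<Y) (c+r<span bw cw 1≤X))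
                  (fill-towardsCentre-row (subst (_≤ centreDist bw cw (toℕ j)) (sym (centreDist-centre bw cw 1≤X)) z≤n) Mij)
        ; bounded = bounded
        }
        where
        centreDist-at : ∀ b c {n} {k : Fin n} {r} → toℕ k ≡ c + r → centreDist b c (toℕ k) ≡ r
        centreDist-at b c k≡ = trans (cong (centreDist b c) k≡) (centreDist-+ b c _)

        downClosed : ∀ {r c r′ c′} → r′ ≤ r → c′ ≤ c →
                     quadrant cw ch M r c ≡ true → quadrant cw ch M r′ c′ ≡ true
        downClosed {r} {c} {r′} {c′} r′≤r c′≤c filled with cellAt-true M _ _ filled
        ... | i , j , i≡ , j≡ , Mij =
          trans (cellAt-fromℕ< M r′< c′<) (fill-towardsCentre-column closerRow (fill-towardsCentre-row closerColumn Mij))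
          where
          c′< : cw + c′ < W
          c′< = ≤-<-trans (+-monoʳ-≤ cw c′≤c) (subst (_< W) j≡ (toℕ<n j))
          r′< : ch + r′ < H
          r′< = ≤-<-trans (+-monoʳ-≤ ch r′≤r) (subst (_< H) i≡ (toℕ<n i))
          closerColumn : centreDist bw cw (toℕ (fromℕ< c′<)) ≤ centreDist bw cw (toℕ j)
          closerColumn = subst₂ _≤_ (sym (centreDist-at bw cw (toℕ-fromℕ< c′<))) (sym (centreDist-at bw cw j≡)) c′≤c
          closerRow : centreDist bh ch (toℕ (fromℕ< r′<)) ≤ centreDist bh ch (toℕ i)
          closerRow = subst₂ _≤_ (sym (centreDist-at bh ch (toℕ-fromℕ< r′<))) (sym (centreDist-at bh ch i≡)) r′≤r

        bounded : ∀ {r c} → quadrant cw ch M r c ≡ true → r < Y × c < X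
        bounded filled with cellAt-true M _ _ filled
        ... | i , j , i≡ , j≡ , _ =
          +-cancelˡ-< ch _ _ (subst₂ _<_ i≡ (span≡c+halfSpan bh ch) (toℕ<n i)) ,
          +-cancelˡ-< cw _ _ (subst₂ _<_ j≡ (span≡c+halfSpan bw cw) (toℕ<n j))

<ᵇ-true⁺ : ∀ {m n} → m < n → (m <ᵇ n) ≡ true
<ᵇ-true⁺ m<n = Equivalence.to T-≡ (<⇒<ᵇ m<n)

<ᵇ-true⁻ : ∀ {m n} → (m <ᵇ n) ≡ true → m < n
<ᵇ-true⁻ {m} {n} m<ᵇn = <ᵇ⇒< m n (Equivalence.from T-≡ m<ᵇn)

-- The r-th part of a partition, and 0 beyond its length.
part : List ℕ → ℕ → ℕ
part [] r = 0
part (x ∷ p) zero = x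
part (x ∷ p) (suc r) = part p r

cells : List ℕ → ℕ → ℕ → Bool
cells p r c = c <ᵇ part p r

part-zero : ∀ p → part p 0 ≡ largestPart p
part-zero [] = refl
part-zero (x ∷ p) = refl

part-antitone : ∀ {p} → Linked _≥_ p → ∀ {r r′} → r′ ≤ r → part p r ≤ part p r′
part-antitone [] _ = z≤n
part-antitone [-] {zero} z≤n = ≤-refl
part-antitone [-] {suc r} {zero} _ = z≤n
part-antitone [-] {suc r} {suc r′} _ = z≤n
part-antitone (y≤x ∷ linked) {zero} z≤n = ≤-refl
part-antitone (y≤x ∷ linked) {suc r} {zero} _ = ≤-trans (part-antitone linked {r} z≤n) y≤x
part-antitone (y≤x ∷ linked) {suc r} {suc r′} (s≤s r′≤r) = part-antitone linked r′≤r

part≤largestPart : ∀ {p} → Linked _≥_ p → ∀ r → part p r ≤ largestPart p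
part≤largestPart {p} linked r = subst (part p r ≤_) (part-zero p) (part-antitone linked z≤n)

part-positive : ∀ {p} → All (λ x → 1 ≤ x) p → ∀ {r} → r < length p → 1 ≤ part p r
part-positive (1≤x ∷ _) {zero} _ = 1≤x
part-positive (_ ∷ positive) {suc r} (s≤s r<) = part-positive positive r<

part-positive⁻ : ∀ p {r} → 1 ≤ part p r → r < length p
part-positive⁻ (x ∷ p) {zero} _ = s≤s z≤n
part-positive⁻ (x ∷ p) {suc r} 1≤part = s≤s (part-positive⁻ p 1≤part)

cells-shape : ∀ {p} → IsFerrers p → FerrersShape (cells p) (largestPart p) (length p)
cells-shape {p} (positive , linked) = record
  { downClosed = λ r′≤r c′≤c filled →
      <ᵇ-true⁺ (≤-<-trans c′≤c (<-≤-trans (<ᵇ-true⁻ filled) (part-antitone linked r′≤r)))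
  ; firstRow = λ {c} c<L → <ᵇ-true⁺ (subst (c <_) (sym (part-zero p)) c<L)
  ; firstColumn = λ r<ℓ → <ᵇ-true⁺ (part-positive positive r<ℓ)
  ; bounded = λ {r} filled → let c<part = <ᵇ-true⁻ filled in
      part-positive⁻ p (≤-<-trans z≤n c<part) , <-≤-trans c<part (part≤largestPart linked r)
  }

sumTo-part : ∀ p → sumTo (length p) (part p) ≡ sum p
sumTo-part [] = refl
sumTo-part (x ∷ p) = cong (x +_) (sumTo-part p)

shapeSize-cells : ∀ {p} → IsFerrers p → shapeSize (cells p) (largestPart p) (length p) ≡ sum p
shapeSize-cells {p} (_ , linked) =
  trans (sumTo-cong (length p) (λ {r} _ → count-<ᵇ (largestPart p) (part≤largestPart linked r))) (sumTo-part p)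

rowLengths : (ℕ → ℕ → Bool) → ℕ → ℕ → List ℕ
rowLengths Q X Y = applyUpTo (λ r → count X (Q r)) Y

part-applyUpTo : ∀ f {k r} → r < k → part (applyUpTo f k) r ≡ f r
part-applyUpTo f {suc k} {zero} _ = refl
part-applyUpTo f {suc k} {suc r} (s≤s r<k) = part-applyUpTo (f ∘ suc) r<k

part-applyUpTo-≥ : ∀ f {k r} → k ≤ r → part (applyUpTo f k) r ≡ 0
part-applyUpTo-≥ f {zero} _ = refl
part-applyUpTo-≥ f {suc k} {suc r} (s≤s k≤r) = part-applyUpTo-≥ (f ∘ suc) k≤r

applyUpTo-part : ∀ p → applyUpTo (part p) (length p) ≡ p
applyUpTo-part [] = refl
applyUpTo-part (x ∷ p) = cong (x ∷_) (applyUpTo-part p)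

applyUpTo-cong : ∀ k {f g : ℕ → ℕ} → (∀ {r} → r < k → f r ≡ g r) → applyUpTo f k ≡ applyUpTo g k
applyUpTo-cong zero _ = refl
applyUpTo-cong (suc k) f≗g = cong₂ _∷_ (f≗g (s≤s z≤n)) (applyUpTo-cong k (f≗g ∘ s≤s))

applyUpTo-Linked : ∀ k {f} → (∀ r → f (suc r) ≤ f r) → Linked _≥_ (applyUpTo f k)
applyUpTo-Linked zero _ = []
applyUpTo-Linked (suc zero) _ = [-]
applyUpTo-Linked (suc (suc k)) antitone = antitone 0 ∷ applyUpTo-Linked (suc k) (antitone ∘ suc)

rowLengths-cells : ∀ {p} → IsFerrers p → rowLengths (cells p) (largestPart p) (length p) ≡ p
rowLengths-cells {p} (_ , linked) =
  trans (applyUpTo-cong (length p) (λ {r} _ → count-<ᵇ (largestPart p) (part≤largestPart linked r))) (applyUpTo-part p)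

rowLengths-cong : ∀ {Q Q′ X} Y → (∀ {r c} → r < Y → c < X → Q r c ≡ Q′ r c) → rowLengths Q X Y ≡ rowLengths Q′ X Y
rowLengths-cong {X = X} Y Q≗Q′ = applyUpTo-cong Y (λ r<Y → sumTo-cong X (λ c<X → cong bit (Q≗Q′ r<Y c<X)))

module _ {Q X Y} (shape : FerrersShape Q X Y) where
  open FerrersShape shape

  rowLengths-Ferrers : 1 ≤ X → IsFerrers (rowLengths Q X Y)
  rowLengths-Ferrers 1≤X =
    All.applyUpTo⁺₁ _ Y (λ r<Y → count-positive X 1≤X (firstColumn r<Y)) ,
    applyUpTo-Linked Y (λ r → count-mono X (downClosed (n≤1+n r) ≤-refl))

  largestPart-rowLengths : 1 ≤ Y → largestPart (rowLengths Q X Y) ≡ X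
  largestPart-rowLengths 1≤Y =
    trans (sym (part-zero (rowLengths Q X Y))) (trans (part-applyUpTo _ 1≤Y) (count-all X firstRow))

  outside-false : ∀ {r c} → (r < Y × c < X → ⊥) → Q r c ≡ false
  outside-false outside = ¬-not (outside ∘ bounded)

  cells-rowLengths : ∀ r c → cells (rowLengths Q X Y) r c ≡ Q r c
  cells-rowLengths r c with r <? Y
  ... | yes r<Y = trans (cong (c <ᵇ_) (part-applyUpTo _ r<Y))
                        (sym (count-initialSegment X (downClosed ≤-refl)
                                (λ X≤c → outside-false (λ (_ , c<X) → <⇒≱ c<X X≤c)) c))
  ... | no r≮Y = trans (cong (c <ᵇ_) (part-applyUpTo-≥ _ (≮⇒≥ r≮Y))) (sym (outside-false (r≮Y ∘ proj₁)))

-- The Ferrers shape of a partition p, read row by row (t = false) or column by column (t = true).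
shapeOf : Bool → List ℕ → ℕ → ℕ → Bool
shapeOf false p = cells p
shapeOf true p = flip (cells p)

columnsOf rowsOf : Bool → List ℕ → ℕ
columnsOf false p = largestPart p
columnsOf true p = length p
rowsOf false p = length p
rowsOf true p = largestPart p

partitionOf : Bool → (ℕ → ℕ → Bool) → ℕ → ℕ → List ℕ
partitionOf false Q X Y = rowLengths Q X Y
partitionOf true Q X Y = rowLengths (flip Q) Y X

record Encodes (t : Bool) (p : List ℕ) (Q : ℕ → ℕ → Bool) (X Y : ℕ) : Set where
  field
    ferrers : IsFerrers p
    nonEmpty : NonEmptyList p
    columns≡ : columnsOf t p ≡ X
    rows≡ : rowsOf t p ≡ Y
    shape≡ : ∀ r c → shapeOf t p r c ≡ Q r c

1≤largestPart : ∀ {p} → IsFerrers p → NonEmptyList p → 1 ≤ largestPart p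
1≤largestPart {[]} _ ()
1≤largestPart {x ∷ _} (1≤x ∷ _ , _) _ = 1≤x

module _ {p : List ℕ} (ferrers : IsFerrers p) where

  shapeOf-shape : ∀ t → FerrersShape (shapeOf t p) (columnsOf t p) (rowsOf t p)
  shapeOf-shape false = cells-shape ferrers
  shapeOf-shape true = FerrersShape-transpose (cells-shape ferrers)

  shapeSize-shapeOf : ∀ t → shapeSize (shapeOf t p) (columnsOf t p) (rowsOf t p) ≡ sum p
  shapeSize-shapeOf false = shapeSize-cells ferrers
  shapeSize-shapeOf true = trans (shapeSize-transpose (cells p) (largestPart p) (length p)) (shapeSize-cells ferrers)

  partitionOf-shapeOf : ∀ t → partitionOf t (shapeOf t p) (columnsOf t p) (rowsOf t p) ≡ p
  partitionOf-shapeOf false = rowLengths-cells ferrers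
  partitionOf-shapeOf true = rowLengths-cells ferrers

  module _ (nonEmpty : NonEmptyList p) where

    1≤columnsOf : ∀ t → 1 ≤ columnsOf t p
    1≤columnsOf false = 1≤largestPart ferrers nonEmpty
    1≤columnsOf true = nonEmpty

    1≤rowsOf : ∀ t → 1 ≤ rowsOf t p
    1≤rowsOf false = nonEmpty
    1≤rowsOf true = 1≤largestPart ferrers nonEmpty

partitionOf-cong : ∀ t {Q Q′ X Y} → (∀ {r c} → r < Y → c < X → Q r c ≡ Q′ r c) →
  partitionOf t Q X Y ≡ partitionOf t Q′ X Y
partitionOf-cong false {Y = Y} Q≗Q′ = rowLengths-cong Y Q≗Q′
partitionOf-cong true {X = X} Q≗Q′ = rowLengths-cong X (λ c<X r<Y → Q≗Q′ r<Y c<X)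

rowLengths-encodes : ∀ {Q X Y} → FerrersShape Q X Y → 1 ≤ X → 1 ≤ Y → Encodes false (rowLengths Q X Y) Q X Y
rowLengths-encodes {Q} {X} {Y} shape 1≤X 1≤Y = record
  { ferrers = rowLengths-Ferrers shape 1≤X
  ; nonEmpty = subst (1 ≤_) (sym (List.length-applyUpTo _ Y)) 1≤Y
  ; columns≡ = largestPart-rowLengths shape 1≤Y
  ; rows≡ = List.length-applyUpTo _ Y
  ; shape≡ = cells-rowLengths shape
  }

partitionOf-encodes : ∀ t {Q X Y} → FerrersShape Q X Y → 1 ≤ X → 1 ≤ Y → Encodes t (partitionOf t Q X Y) Q X Y
partitionOf-encodes false = rowLengths-encodes
partitionOf-encodes true shape 1≤X 1≤Y = record
  { ferrers = ferrers
  ; nonEmpty = nonEmpty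
  ; columns≡ = rows≡
  ; rows≡ = columns≡
  ; shape≡ = λ r c → shape≡ c r
  }
  where open Encodes (rowLengths-encodes (FerrersShape-transpose shape) 1≤Y 1≤X)

-- The four parity classes

HVClass : Bool → Bool → ℕ → ℕ → Poly → Set
HVClass bw bh n a y = (HVConvex n a y × isOdd (proj₁ y) ≡ bw) × isOdd (proj₁ (proj₂ y)) ≡ bh

halfPerimeter : Poly → ℕ
halfPerimeter (w , h , _) = w + h

polyArea : Poly → ℕ
polyArea (_ , _ , M) = area M

module ParityClass (bw bh t : Bool) where

  doubleCounted : List ℕ → ℕ
  doubleCounted p = bit bw * (2 * rowsOf t p) + bit bh * (2 * columnsOf t p)

  Term : ℕ → ℕ → List ℕ → Set
  Term n a p = IsFerrers p × NonEmptyList p ×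
    2 * columnsOf t p + 2 * rowsOf t p ≡ n + (bit bw + bit bh) ×
    4 * sum p + bit bw * bit bh ≡ a + doubleCounted p

  unfoldPoly : ℕ → ℕ → (ℕ → ℕ → Bool) → Poly
  unfoldPoly cw ch Q = span bw cw , span bh ch , Unfolding.unfold bw cw bh ch Q

  polyomino : List ℕ → Poly
  polyomino p = unfoldPoly (columnsOf t p ∸ bit bw) (rowsOf t p ∸ bit bh) (shapeOf t p)

  quadrantPartition : Poly → List ℕ
  quadrantPartition (w , h , M) =
    partitionOf t (quadrant ⌊ w /2⌋ ⌊ h /2⌋ M) (halfSpan bw ⌊ w /2⌋) (halfSpan bh ⌊ h /2⌋)

  module _ {p} (ferrers : IsFerrers p) (nonEmpty : NonEmptyList p) where
    private
      cw ch : ℕ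
      cw = columnsOf t p ∸ bit bw
      ch = rowsOf t p ∸ bit bh

    halfSpan-cw : halfSpan bw cw ≡ columnsOf t p
    halfSpan-cw = m∸n+n≡m (≤-trans (bit≤1 bw) (1≤columnsOf ferrers nonEmpty t))

    halfSpan-ch : halfSpan bh ch ≡ rowsOf t p
    halfSpan-ch = m∸n+n≡m (≤-trans (bit≤1 bh) (1≤rowsOf ferrers nonEmpty t))

    polyomino-shape : FerrersShape (shapeOf t p) (halfSpan bw cw) (halfSpan bh ch)
    polyomino-shape = subst₂ (FerrersShape (shapeOf t p)) (sym halfSpan-cw) (sym halfSpan-ch) (shapeOf-shape ferrers t)

    halfPerimeter-polyomino : halfPerimeter (polyomino p) + (bit bw + bit bh) ≡ 2 * columnsOf t p + 2 * rowsOf t p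
    halfPerimeter-polyomino =
      trans (interchange (span bw cw) (span bh ch) (bit bw) (bit bh))
            (cong₂ _+_ (trans (span+bit≡2*halfSpan bw cw) (cong (2 *_) halfSpan-cw))
                       (trans (span+bit≡2*halfSpan bh ch) (cong (2 *_) halfSpan-ch)))

    area-polyomino : polyArea (polyomino p) + doubleCounted p ≡ 4 * sum p + bit bw * bit bh
    area-polyomino = begin
      polyArea (polyomino p) + doubleCounted p
        ≡⟨ cong₂ (λ X Y → polyArea (polyomino p) + (bit bw * (2 * Y) + bit bh * (2 * X))) halfSpan-cw halfSpan-ch ⟨
      polyArea (polyomino p) + (bit bw * (2 * halfSpan bh ch) + bit bh * (2 * halfSpan bw cw))
        ≡⟨ Unfolding.area-unfold bw cw bh ch polyomino-shape ⟩
      4 * shapeSize (shapeOf t p) (halfSpan bw cw) (halfSpan bh ch) + bit bw * bit bh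
        ≡⟨ cong (λ s → 4 * s + bit bw * bit bh)
                (trans (cong₂ (shapeSize (shapeOf t p)) halfSpan-cw halfSpan-ch) (shapeSize-shapeOf ferrers t)) ⟩
      4 * sum p + bit bw * bit bh ∎
      where open ≡-Reasoning

    quadrantPartition-polyomino : quadrantPartition (polyomino p) ≡ p
    quadrantPartition-polyomino rewrite ⌊span/2⌋ bw cw | ⌊span/2⌋ bh ch =
      trans (partitionOf-cong t (Unfolding.quadrant-unfold bw cw bh ch (shapeOf t p)))
            (trans (cong₂ (partitionOf t (shapeOf t p)) halfSpan-cw halfSpan-ch) (partitionOf-shapeOf ferrers t))

  module _ {n a : ℕ} where

    sound : ∀ {p} → Term n a p → HVClass bw bh n a (polyomino p)
    sound {p} (ferrers , nonEmpty , perimeter , area≡) =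
      ((unfold-polyomino shape 1≤X 1≤Y , unfold-convex shape , unfold-hsym (shapeOf t p) , unfold-vsym (shapeOf t p) ,
        +-cancelʳ-≡ _ _ _ (trans (halfPerimeter-polyomino ferrers nonEmpty) perimeter) ,
        +-cancelʳ-≡ _ _ _ (trans (area-polyomino ferrers nonEmpty) area≡)) ,
       isOdd-span bw (columnsOf t p ∸ bit bw)) ,
      isOdd-span bh (rowsOf t p ∸ bit bh)
      where
      open Unfolding bw (columnsOf t p ∸ bit bw) bh (rowsOf t p ∸ bit bh)
      shape : FerrersShape (shapeOf t p) X Y
      shape = polyomino-shape ferrers nonEmpty
      1≤X : 1 ≤ X
      1≤X = subst (1 ≤_) (sym (halfSpan-cw ferrers nonEmpty)) (1≤columnsOf ferrers nonEmpty t)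
      1≤Y : 1 ≤ Y
      1≤Y = subst (1 ≤_) (sym (halfSpan-ch ferrers nonEmpty)) (1≤rowsOf ferrers nonEmpty t)

    injective : ∀ {p q} → Term n a p → Term n a q → polyomino p ≡ polyomino q → p ≡ q
    injective {p} {q} (ferrersp , nonEmptyp , _) (ferrersq , nonEmptyq , _) p≡q =
      trans (sym (quadrantPartition-polyomino ferrersp nonEmptyp))
            (trans (cong quadrantPartition p≡q) (quadrantPartition-polyomino ferrersq nonEmptyq))

    surjective-span : ∀ cw ch (M : Grid (span bw cw) (span bh ch)) → HVConvex n a (span bw cw , span bh ch , M) →
      ∃ λ p → Term n a p × polyomino p ≡ (span bw cw , span bh ch , M)
    surjective-span cw ch M (((cell , _) , _ , tight) , convex , hsym , vsym , perimeter , area≡) =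
      p , (ferrers , nonEmpty , perimeter′ , area′) , polyomino≡
      where
      open Unfolding bw cw bh ch
      1≤X : 1 ≤ X
      1≤X = 1≤halfSpan bw cw (≤-<-trans z≤n (toℕ<n (proj₂ cell)))
      1≤Y : 1 ≤ Y
      1≤Y = 1≤halfSpan bh ch (≤-<-trans z≤n (toℕ<n (proj₁ cell)))
      p : List ℕ
      p = partitionOf t (quadrant cw ch M) X Y
      open Encodes (partitionOf-encodes t (quadrant-shape M hsym vsym convex tight 1≤X 1≤Y) 1≤X 1≤Y)

      polyomino≡ : polyomino p ≡ (span bw cw , span bh ch , M)
      polyomino≡ = begin
        unfoldPoly (columnsOf t p ∸ bit bw) (rowsOf t p ∸ bit bh) (shapeOf t p)
          ≡⟨ cong₂ (λ cw′ ch′ → unfoldPoly cw′ ch′ (shapeOf t p))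
                   (trans (cong (_∸ bit bw) columns≡) (m+n∸n≡m cw (bit bw)))
                   (trans (cong (_∸ bit bh) rows≡) (m+n∸n≡m ch (bit bh))) ⟩
        unfoldPoly cw ch (shapeOf t p)
          ≡⟨ cong (λ G → span bw cw , span bh ch , G) (trans (unfold-cong shape≡) (unfold-quadrant M hsym vsym)) ⟩
        (span bw cw , span bh ch , M) ∎
        where open ≡-Reasoning

      perimeter′ : 2 * columnsOf t p + 2 * rowsOf t p ≡ n + (bit bw + bit bh)
      perimeter′ = trans (sym (halfPerimeter-polyomino ferrers nonEmpty))
                         (cong (_+ (bit bw + bit bh)) (trans (cong halfPerimeter polyomino≡) perimeter))

      area′ : 4 * sum p + bit bw * bit bh ≡ a + doubleCounted p
      area′ = trans (sym (area-polyomino ferrers nonEmpty)) (cong (_+ doubleCounted p) (trans (cong polyArea polyomino≡) area≡))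

    surjective : ∀ {y} → HVClass bw bh n a y → ∃ λ p → Term n a p × polyomino p ≡ y
    surjective {w , h , M} ((hv , oddW) , oddH) with spanForm w oddW | spanForm h oddH
      where
      spanForm : ∀ m {b} → isOdd m ≡ b → ∃ λ c → span b c ≡ m
      spanForm m refl = ⌊ m /2⌋ , span-isOdd-⌊/2⌋ m
    ... | cw , refl | ch , refl = surjective-span cw ch M hv

    IsCount-HVClass : ∀ {k} → IsCount (Term n a) k → IsCount (HVClass bw bh n a) k
    IsCount-HVClass = IsCount-image polyomino injective sound surjective

boundedLists : ℕ → ℕ → List (List ℕ)
boundedLists zero B = [] ∷ []
boundedLists (suc ℓ) B = [] ∷ cartesianProductWith _∷_ (upTo (suc B)) (boundedLists ℓ B)

∈-boundedLists : ∀ ℓ B {p} → length p ≤ ℓ → All (_≤ B) p → p ∈ boundedLists ℓ B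
∈-boundedLists zero B {[]} _ [] = here refl
∈-boundedLists (suc ℓ) B {[]} _ [] = here refl
∈-boundedLists (suc ℓ) B {x ∷ p} (s≤s length≤ℓ) (x≤B ∷ parts≤B) =
  there (∈-cartesianProductWith⁺ _∷_ (∈-upTo⁺ (s≤s x≤B)) (∈-boundedLists ℓ B length≤ℓ parts≤B))

All≤largestPart : ∀ {p} → Linked _≥_ p → All (_≤ largestPart p) p
All≤largestPart [] = []
All≤largestPart [-] = ≤-refl ∷ []
All≤largestPart (y≤x ∷ linked) = ≤-refl ∷ All.map (λ z≤y → ≤-trans z≤y y≤x) (All≤largestPart linked)

IsFerrers? : Decidable IsFerrers
IsFerrers? p = all? (1 ≤?_) p ×-dec linked? (λ m n → n ≤? m) p

IsCount-Ferrers : ∀ N {E : List ℕ → Set} → Decidable E → (∀ {p} → E p → 2 * largestPart p + 2 * length p ≤ N) →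
  ∃ (IsCount (λ p → IsFerrers p × NonEmptyList p × E p))
IsCount-Ferrers N {E} E? bound =
  IsCount-decidable (List.≡-dec _≟_) (λ p → IsFerrers? p ×-dec (1 ≤? length p) ×-dec E? p) (boundedLists N N) candidate
  where
  candidate : ∀ {p} → IsFerrers p × NonEmptyList p × E p → p ∈ boundedLists N N
  candidate {p} ((_ , linked) , _ , e) =
    ∈-boundedLists N N ℓ≤N (All.map (λ x≤L → ≤-trans x≤L L≤N) (All≤largestPart linked))
    where
    L≤N : largestPart p ≤ N
    L≤N = ≤-trans (m≤m+n (largestPart p) _) (≤-trans (m≤m+n (2 * largestPart p) _) (bound e))
    ℓ≤N : length p ≤ N
    ℓ≤N = ≤-trans (m≤m+n (length p) _) (≤-trans (m≤n+m (2 * length p) (2 * largestPart p)) (bound e))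

≡⇔≡ : ∀ {a b c d : ℕ} → a ≡ c → b ≡ d → (a ≡ b) ⇔ (c ≡ d)
≡⇔≡ a≡c b≡d = mk⇔ (λ a≡b → trans (sym a≡c) (trans a≡b b≡d)) (λ c≡d → trans a≡c (trans c≡d (sym b≡d)))

module Even×Even = ParityClass false false false
module Even×Odd = ParityClass false true false
-- Transposed, so that the double-counted central column has the length of the largest part, as in TermB.
module Odd×Even = ParityClass true false true
module Odd×Odd = ParityClass true true false

TermA⇔ : ∀ n a p → TermA n a p ⇔ Even×Even.Term n a p
TermA⇔ n a p =
  ⇔-refl ×-⇔ ⇔-refl ×-⇔ ≡⇔≡ refl (sym (+-identityʳ n)) ×-⇔ ≡⇔≡ (sym (+-identityʳ _)) (sym (+-identityʳ a))

TermB⇔Even×Odd : ∀ n a p → TermB n a p ⇔ Even×Odd.Term n a p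
TermB⇔Even×Odd n a p =
  ⇔-refl ×-⇔ ⇔-refl ×-⇔ ≡⇔≡ refl refl ×-⇔ ≡⇔≡ (sym (+-identityʳ _)) (cong (a +_) (sym (+-identityʳ _)))

TermB⇔Odd×Even : ∀ n a p → TermB n a p ⇔ Odd×Even.Term n a p
TermB⇔Odd×Even n a p =
  ⇔-refl ×-⇔ ⇔-refl ×-⇔ ≡⇔≡ (+-comm (2 * largestPart p) _) refl ×-⇔
  ≡⇔≡ (sym (+-identityʳ _)) (cong (a +_) (sym (trans (+-identityʳ _) (+-identityʳ _))))

TermC⇔ : ∀ n a p → TermC n a p ⇔ Odd×Odd.Term n a p
TermC⇔ n a p = ⇔-refl ×-⇔ ⇔-refl ×-⇔ ≡⇔≡ refl refl ×-⇔ ≡⇔≡ refl (arithmetic a (largestPart p) (length p))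
  where
  arithmetic : ∀ a x y → a + 2 * x + 2 * y ≡ a + (1 * (2 * y) + 1 * (2 * x))
  arithmetic = solve-∀

IsCount-TermA : ∀ n a → ∃ (IsCount (TermA n a))
IsCount-TermA n a =
  IsCount-Ferrers (n + 2) (λ _ → (_ ≟ _) ×-dec (_ ≟ _)) (λ (perimeter , _) → ≤-trans (≤-reflexive perimeter) (m≤m+n n 2))

IsCount-TermB : ∀ n a → ∃ (IsCount (TermB n a))
IsCount-TermB n a =
  IsCount-Ferrers (n + 2) (λ _ → (_ ≟ _) ×-dec (_ ≟ _))
    (λ (perimeter , _) → ≤-trans (≤-reflexive perimeter) (+-monoʳ-≤ n (s≤s z≤n)))

IsCount-TermC : ∀ n a → ∃ (IsCount (TermC n a))
IsCount-TermC n a = IsCount-Ferrers (n + 2) (λ _ → (_ ≟ _) ×-dec (_ ≟ _)) (λ (perimeter , _) → ≤-reflexive perimeter)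

mainTheorem17 : (n a : ℕ) →
    Σ ℕ λ k → Σ ℕ λ kA → Σ ℕ λ kB → Σ ℕ λ kC →
      IsCount (HVConvex n a) k × IsCount (TermA n a) kA ×
      IsCount (TermB n a) kB × IsCount (TermC n a) kC ×
      k ≡ kA + 2 * kB + kC
mainTheorem17 n a with IsCount-TermA n a | IsCount-TermB n a | IsCount-TermC n a
... | kA , countA | kB , countB | kC , countC =
  kA + kB + (kB + kC) , kA , kB , kC ,
  IsCount-split (isOdd ∘ proj₁)
    (IsCount-split (isOdd ∘ proj₁ ∘ proj₂)
      (Even×Even.IsCount-HVClass (IsCount-⇔ (TermA⇔ n a) countA))
      (Even×Odd.IsCount-HVClass (IsCount-⇔ (TermB⇔Even×Odd n a) countB)))
    (IsCount-split (isOdd ∘ proj₁ ∘ proj₂)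
      (Odd×Even.IsCount-HVClass (IsCount-⇔ (TermB⇔Odd×Even n a) countB))
      (Odd×Odd.IsCount-HVClass (IsCount-⇔ (TermC⇔ n a) countC))) ,
  countA , countB , countC , arithmetic kA kB kC
  where
  arithmetic : ∀ x y z → x + y + (y + z) ≡ x + 2 * y + z
  arithmetic = solve-∀
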